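{- Let $n\ge 2$ and let $\boldsymbol{u}^i,\boldsymbol{u}^j\in U(n)$ with $i\neq j$. Then the outer product $\boldsymbol{u}^i\boldsymbol{u}^j$ lies in $\overline{V}_n$.
   Context: $\overline{V}_n$ is the space of real $n\times n$ matrices $(x_{ab})_{1\le a,b\le n}$ all of whose row sums and column sums are zero and which additionally satisfy $\sum_{a=1}^n x_{a,a}=0$ and $\sum_{a=1}^n x_{a,n-a+1}=0$. For $\boldsymbol{a},\boldsymbol{b}\in\mathbb{R}^n$, the outer product $\boldsymbol{a}\boldsymbol{b}$ is the $n\times n$ matrix whose $(p,q)$ entry is $a_pb_q$. Definition of $\boldsymbol{w}(k)$ for integers $k\geq 2$: $\boldsymbol{w}(k)=(w(k)_0,\dots,w(k)_{k-1})$, where: if $k$ is odd, $w(k)_i=(k-1)/2$ for $i$ even and $w(k)_i=-(k+1)/2$ for $i$ odd; $\boldsymbol{w}(2)=(1,-1)$; $\boldsymbol{w}(4)=(1,-1,-1,1)$; if $k=2m$ is even with $k>4$, $w(k)_i=w(m)_{i \bmod m}$ for $0\le i\le k-1$. Definition of $U(n)$: build a rooted, vector-labeled binary tree $T_n$. The root is labeled $\boldsymbol{w}(n)\in\mathbb{R}^n$. For a vertex with label $\boldsymbol{u}$, let $i_0<\dots<i_{a'-1}$ be the indices with $u_i>0$ and $j_0<\dots<j_{a''-1}$ those with $u_j<0$. If $a'\ge2$, the vertex gets a left child labeled $\boldsymbol{u}'$ with $u'_{i_r}=w(a')_r$ and $u'_i=0$ otherwise. If $a''\ge 2$, it gets a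 right child labeled $\boldsymbol{u}''$ with $u''_{j_r}=w(a'')_r$ and $0$ otherwise. If $a'=a''=1$ the vertex is a leaf. $U(n)=\{\boldsymbol{u}^1,\dots,\boldsymbol{u}^{n-1}\}$, where $\boldsymbol{u}^i$ is the label of the $i$-th vertex visited in a depth-first (preorder) traversal of $T_n$, left child before right child. -}

module Defs where

open import Data.Nat as N using (ℕ; zero; suc; _%_; _/_; _∸_)
open import Data.Nat.Base using (_<ᵇ_; _≡ᵇ_)
open import Data.Integer as ℤ using (ℤ; +_; -_; 0ℤ)
open import Data.Integer.Properties using ()
open import Data.Fin using (Fin; toℕ; opposite)
open import Data.Vec using (tabulate)
import Data.Vec as Vec
open import Data.Bool using (Bool; true; false; if_then_else_)
open import Data.List using (List; []; _∷_; _++_)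
open import Relation.Nullary.Decidable using (does)
open import Relation.Binary.PropositionalEquality using (_≡_)

Σ : {n : ℕ} → (Fin n → ℤ) → ℤ
Σ f = Vec.foldr _ ℤ._+_ 0ℤ (tabulate f)

-- i mod m (m > 0 in every use)
modS : ℕ → ℕ → ℕ
modS i zero    = i
modS i (suc m) = i % suc m

-- w(k)_i, computed with fuel (each recursive call halves k, so fuel k suffices).
wF : ℕ → ℕ → ℕ → ℤ
wF zero    k i = 0ℤ
wF (suc f) k i =
  if k % 2 ≡ᵇ 1
    then (if i % 2 ≡ᵇ 0 then + ((k ∸ 1) / 2) else - (+ ((k + 1) / 2)))
    else (if k ≡ᵇ 2
      then (if i ≡ᵇ 0 then + 1 else - (+ 1))
      else (if k ≡ᵇ 4
        then (if (i ≡ᵇ 0) Data.Bool.∨ (i ≡ᵇ 3) then + 1 else - (+ 1))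
        else wF f (k / 2) (modS i (k / 2))))
  where open N using (_+_)

-- w(k)_i for 0 ≤ i < k (only meaningful for k ≥ 2)
w : ℕ → ℕ → ℤ
w k i = wF k k i

isPos : ℤ → Bool
isPos x = does (0ℤ ℤ.<? x)

isNeg : ℤ → Bool
isNeg x = does (x ℤ.<? 0ℤ)

cnt : {n : ℕ} → (ℤ → Bool) → (Fin n → ℤ) → ℕ
cnt {n} p u = Vec.sum (tabulate (λ i → if p (u i) then 1 else 0))

-- number of indices j < i with p (u j) true  (the rank r of i among i_0<i_1<...)
rank : {n : ℕ} → (ℤ → Bool) → (Fin n → ℤ) → Fin n → ℕ
rank {n} p u i =
  Vec.sum (tabulate {n = n} (λ j → if (toℕ j <ᵇ toℕ i) Data.Bool.∧ p (u j) then 1 else 0))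

-- child label: u'_{i_r} = w(a)_r on the selected indices, 0 elsewhere
child : {n : ℕ} → (ℤ → Bool) → (Fin n → ℤ) → Fin n → ℤ
child p u i = if p (u i) then w (cnt p u) (rank p u i) else 0ℤ

-- preorder traversal of the subtree rooted at label u (fuel-bounded; the number of
-- nonzero entries strictly decreases along edges, so fuel n suffices for T_n)
preorder : {n : ℕ} → ℕ → (Fin n → ℤ) → List (Fin n → ℤ)
preorder zero    u = []
preorder (suc f) u =
  u ∷ ((if 2 N.≤ᵇ cnt isPos u then preorder f (child isPos u) else [])
       ++ (if 2 N.≤ᵇ cnt isNeg u then preorder f (child isNeg u) else []))

-- U(n) as the list (u^1, ..., u^{n-1}) in preorder
U : (n : ℕ) → List (Fin n → ℤ)
U n = preorder n (λ i → w n (toℕ i))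

outer : {n : ℕ} → (Fin n → ℤ) → (Fin n → ℤ) → Fin n → Fin n → ℤ
outer a b p q = a p ℤ.* b q

-- membership in V̄_n (the defining conditions are linear with integer coefficients;
-- an integer matrix lies in the real space V̄_n iff these hold)
record InVbar (n : ℕ) (x : Fin n → Fin n → ℤ) : Set where
  field
    rowSums  : ∀ a → Σ (λ b → x a b) ≡ 0ℤ
    colSums  : ∀ b → Σ (λ a → x a b) ≡ 0ℤ
    diagSum  : Σ (λ a → x a a) ≡ 0ℤ
    antiSum  : Σ (λ a → x a (opposite a)) ≡ 0ℤ

-- Every label u of T_n has zero sum, is constant on its positive entries and on its negative
-- entries, and is palindromic, except for a copy of w(2) on two positions, which is antipalindromic
-- and has no children. A descendant of u through its left (right) child vanishes off the positive
-- (negative) entries of u; it is therefore orthogonal to u, which is constant there, and it has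
-- support disjoint from every descendant through the other child. So distinct labels x, y are
-- orthogonal, and in the outer product x y the row and column sums vanish because Σ x = Σ y = 0,
-- the diagonal sum is ⟨x, y⟩ = 0 and the antidiagonal sum is ± ⟨x, y⟩.
module Submission where

open import Defs
open import Algebra.Bundles using (Monoid)
import Algebra.Properties.Monoid.Sum as MonoidSum
import Algebra.Properties.Semiring.Sum as SemiringSum
open import Data.Bool using (Bool; true; false; if_then_else_; not; _∧_; _∨_; T)
open import Data.Bool.Properties using (not-involutive; if-cong; if-float)
open import Data.Empty using (⊥-elim)
open import Data.Fin as Fin using (Fin; toℕ; opposite) renaming (zero to fzero; suc to fsuc)
import Data.Fin.Permutation as Perm
import Data.Fin.Properties as Fin
open import Data.Integer as ℤ using (ℤ; +_; -_; 0ℤ)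
import Data.Integer.Properties as ℤ
open import Data.Integer.Tactic.RingSolver using (solve-∀)
open import Data.List using (List; []; _∷_; length; lookup)
open import Data.List.Membership.Propositional.Properties using (∈-lookup)
open import Data.List.Relation.Unary.All as All using (All; []; _∷_)
import Data.List.Relation.Unary.All.Properties as All
open import Data.List.Relation.Unary.AllPairs using (AllPairs; []; _∷_)
import Data.List.Relation.Unary.AllPairs.Properties as AllPairs
open import Data.Nat as ℕ using (ℕ; zero; suc; _+_; _*_; _%_; _≤_; _<_; NonZero)
open import Data.Nat.DivMod using (m*n%n≡0; [m+kn]%n≡m%n; m*n/n≡m; m<n⇒m%n≡m; [m+n]%n≡m%n)
import Data.Nat.Properties as ℕ
open import Data.Product using (∃; ∃₂; _×_; _,_; proj₁; proj₂)
open import Data.Sum as Sum using (_⊎_; inj₁; inj₂)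
open import Data.Unit using (tt)
import Data.Vec as Vec
open import Data.Vec.Functional as Vector using (Vector)
open import Function using (_∘_)
open import Level using (0ℓ)
open import Relation.Binary.PropositionalEquality hiding (preorder)
open import Relation.Nullary using (¬_; Dec; yes; no)
open import Relation.Nullary.Reflects using (det; fromEquivalence)

module ℤΣ = SemiringSum ℤ.+-*-semiring
module ℕΣ = SemiringSum ℕ.+-*-semiring

foldr-tabulate : ∀ {A : Set} (_∙_ : A → A → A) (ε : A) {n} (f : Vector A n) →
  Vec.foldr _ _∙_ ε (Vec.tabulate f) ≡ Vector.foldr _∙_ ε f
foldr-tabulate _∙_ ε {zero}  f = refl
foldr-tabulate _∙_ ε {suc n} f = cong (f fzero ∙_) (foldr-tabulate _∙_ ε (f ∘ fsuc))

rank-zero : ∀ {n} p (u : Vector ℤ (suc n)) → rank p u fzero ≡ 0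
rank-zero {n} p u = trans (foldr-tabulate ℕ._+_ 0 {suc n} (λ _ → 0))
                          (ℕΣ.sum-replicate-zero (suc n))

module _ (M : Monoid 0ℓ 0ℓ) where
  open Monoid M using (Carrier; _≈_; _∙_; ε; ∙-cong; ∙-congˡ; assoc; identityˡ)
    renaming (refl to ≈-refl; sym to ≈-sym; trans to ≈-trans; reflexive to ≈-reflexive)
  open MonoidSum M using (sum)

  sum-split : ∀ m n (h : ℕ → Carrier) →
    sum {m + n} (h ∘ toℕ) ≈ sum {m} (h ∘ toℕ) ∙ sum {n} (λ r → h (m + toℕ r))
  sum-split zero    n h = ≈-sym (identityˡ _)
  sum-split (suc m) n h = ≈-trans (∙-congˡ (sum-split m n (h ∘ suc))) (≈-sym (assoc _ _ _))

  sum-by-rank : ∀ {n} p (u : Vector ℤ n) (g : ℕ → Carrier) →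
    sum (λ i → if p (u i) then g (rank p u i) else ε) ≈ sum {cnt p u} (g ∘ toℕ)
  sum-by-rank {zero}  p u g = ≈-refl
  sum-by-rank {suc n} p u g with p (u fzero)
  ... | true  = ∙-cong (≈-reflexive (cong g (rank-zero p u))) (sum-by-rank p (u ∘ fsuc) (g ∘ suc))
  ... | false = ≈-trans (identityˡ _) (sum-by-rank p (u ∘ fsuc) g)

open ℤΣ using (sum; sum-syntax; sum-cong-≗)

Σ≡sum : ∀ {n} (f : Vector ℤ n) → Σ f ≡ sum f
Σ≡sum = foldr-tabulate ℤ._+_ 0ℤ

cnt≡sum : ∀ {n} q (u : Vector ℤ n) → cnt q u ≡ ℕΣ.sum (λ i → if q (u i) then 1 else 0)
cnt≡sum q u = foldr-tabulate ℕ._+_ 0 (λ i → if q (u i) then 1 else 0)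

Σ-cong : ∀ {n} {f g : Vector ℤ n} → (∀ a → f a ≡ g a) → Σ f ≡ Σ g
Σ-cong {f = f} {g} f≗g = trans (Σ≡sum f) (trans (sum-cong-≗ f≗g) (sym (Σ≡sum g)))

Σ-zero : ∀ {n} {f : Vector ℤ n} → (∀ a → f a ≡ 0ℤ) → Σ f ≡ 0ℤ
Σ-zero {n} {f} f≗0 = trans (Σ≡sum f) (trans (sum-cong-≗ f≗0) (ℤΣ.sum-replicate-zero n))

Σ-scaleˡ : ∀ {n} c (f : Vector ℤ n) → Σ (λ a → c ℤ.* f a) ≡ c ℤ.* Σ f
Σ-scaleˡ c f = trans (Σ≡sum (λ a → c ℤ.* f a))
                     (trans (sym (ℤΣ.*-distribˡ-sum c f)) (cong (c ℤ.*_) (sym (Σ≡sum f))))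

Σ-scaleʳ : ∀ {n} c (f : Vector ℤ n) → Σ (λ a → f a ℤ.* c) ≡ Σ f ℤ.* c
Σ-scaleʳ c f = trans (Σ≡sum (λ a → f a ℤ.* c))
                     (trans (sym (ℤΣ.*-distribʳ-sum c f)) (cong (ℤ._* c) (sym (Σ≡sum f))))

m*2≡m+m : ∀ m → m * 2 ≡ m + m
m*2≡m+m m = trans (ℕ.*-comm m 2) (cong (λ x → m + x) (ℕ.+-identityʳ m))

[m+n]%m≡n : ∀ m {n} .{{_ : NonZero m}} → n < m → (m + n) % m ≡ n
[m+n]%m≡n m {n} n<m = trans (cong (_% m) (ℕ.+-comm m n)) (trans ([m+n]%n≡m%n n m) (m<n⇒m%n≡m n<m))

sum-mod-double : ∀ m (h : ℕ → ℤ) → let M = suc m in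
  ∑[ r < M * 2 ] h (toℕ r % M) ≡ ∑[ r < M ] h (toℕ r) ℤ.+ ∑[ r < M ] h (toℕ r)
sum-mod-double m h = begin
  ∑[ r < M * 2 ] h (toℕ r % M)    ≡⟨ cong (λ k → ∑[ r < k ] h (toℕ r % M)) (m*2≡m+m M) ⟩
  ∑[ r < M + M ] h (toℕ r % M)    ≡⟨ sum-split ℤ.+-0-monoid M M (λ r → h (r % M)) ⟩
  ∑[ r < M ] h (toℕ r % M) ℤ.+ ∑[ r < M ] h ((M + toℕ r) % M)
    ≡⟨ cong₂ ℤ._+_ (sum-cong-≗ {M} (λ r → cong h (m<n⇒m%n≡m (Fin.toℕ<n r))))
                   (sum-cong-≗ {M} (λ r → cong h ([m+n]%m≡n M (Fin.toℕ<n r)))) ⟩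
  ∑[ r < M ] h (toℕ r) ℤ.+ ∑[ r < M ] h (toℕ r) ∎
  where
  open ≡-Reasoning
  M = suc m

isEven : ℕ → Bool
isEven zero    = true
isEven (suc n) = not (isEven n)

isEven-%2 : ∀ i → (i % 2 ℕ.≡ᵇ 0) ≡ isEven i
isEven-%2 0             = refl
isEven-%2 1             = refl
isEven-%2 (suc (suc i)) = trans (isEven-%2 i) (sym (not-involutive (isEven i)))

isEven-*2 : ∀ m → isEven (m * 2) ≡ true
isEven-*2 zero    = refl
isEven-*2 (suc m) = trans (not-involutive (isEven (m * 2))) (isEven-*2 m)

isEven-+⇒≡ : ∀ s r → isEven (s + r) ≡ true → isEven s ≡ isEven r
isEven-+⇒≡ s zero    e = trans (cong isEven (sym (ℕ.+-identityʳ s))) e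
isEven-+⇒≡ s (suc r) e = trans (sym (not-involutive (isEven s)))
  (cong not (isEven-+⇒≡ (suc s) r (trans (cong isEven (sym (ℕ.+-suc s r))) e)))

data Parity : ℕ → Set where
  even : ∀ m → Parity (m * 2)
  odd  : ∀ m → Parity (suc (m * 2))

parity : ∀ k → Parity k
parity zero = even 0
parity (suc k) with parity k
... | even m = odd m
... | odd  m = even (suc m)

alternating : ℤ → ℤ → ℕ → ℤ
alternating a b i = if isEven i then a else b

alternating-sum : ∀ a b m → ∑[ r < suc (m * 2) ] alternating a b (toℕ r) ≡ a ℤ.+ + m ℤ.* (a ℤ.+ b)
alternating-sum a b zero    = cong (λ z → a ℤ.+ z) (sym (ℤ.*-zeroˡ (a ℤ.+ b)))
alternating-sum a b (suc m) = begin
  a ℤ.+ (b ℤ.+ ∑[ r < suc (m * 2) ] alternating a b (2 + toℕ r))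
    ≡⟨ cong (λ z → a ℤ.+ (b ℤ.+ z)) (sum-cong-≗ {suc (m * 2)} (shift ∘ toℕ)) ⟩
  a ℤ.+ (b ℤ.+ ∑[ r < suc (m * 2) ] alternating a b (toℕ r))
    ≡⟨ cong (λ z → a ℤ.+ (b ℤ.+ z)) (alternating-sum a b m) ⟩
  a ℤ.+ (b ℤ.+ (a ℤ.+ + m ℤ.* (a ℤ.+ b)))
    ≡⟨ distribute a b (+ m) ⟩
  a ℤ.+ + suc m ℤ.* (a ℤ.+ b) ∎
  where
  open ≡-Reasoning
  shift : ∀ r → alternating a b (2 + r) ≡ alternating a b r
  shift r = cong (λ e → if e then a else b) (not-involutive (isEven r))
  distribute : ∀ a b x →
    a ℤ.+ (b ℤ.+ (a ℤ.+ x ℤ.* (a ℤ.+ b))) ≡ a ℤ.+ (+ 1 ℤ.+ x) ℤ.* (a ℤ.+ b)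
  distribute = solve-∀

-- With no fuel wF is identically zero, so the facts below hold for every amount of fuel.

[1+m*2]%2≡1 : ∀ m → suc (m * 2) % 2 ≡ 1
[1+m*2]%2≡1 m = [m+kn]%n≡m%n 1 m 2

[1+m*2+1]/2≡1+m : ∀ m → (suc (m * 2) + 1) ℕ./ 2 ≡ suc m
[1+m*2+1]/2≡1+m m = trans (cong (ℕ._/ 2) (ℕ.+-comm (suc (m * 2)) 1)) (m*n/n≡m (suc m) 2)

wF-odd : ∀ f m i → wF (suc f) (suc (m * 2)) i ≡ alternating (+ m) (- + suc m) i
wF-odd f m i = begin
  wF (suc f) (suc (m * 2)) i
    ≡⟨ if-cong (cong (ℕ._≡ᵇ 1) ([1+m*2]%2≡1 m)) ⟩
  (if i % 2 ℕ.≡ᵇ 0 then + (m * 2 ℕ./ 2) else - + ((suc (m * 2) + 1) ℕ./ 2))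
    ≡⟨ cong₂ (λ b x → if b then + x else - + ((suc (m * 2) + 1) ℕ./ 2)) (isEven-%2 i) (m*n/n≡m m 2) ⟩
  (if isEven i then + m else - + ((suc (m * 2) + 1) ℕ./ 2))
    ≡⟨ cong (λ x → if isEven i then + m else - + x) ([1+m*2+1]/2≡1+m m) ⟩
  alternating (+ m) (- + suc m) i ∎
  where open ≡-Reasoning

wF-double : ∀ f m i → let M = 3 + m in wF (suc f) (M * 2) i ≡ wF f M (i % M)
wF-double f m i = trans (if-cong (cong (ℕ._≡ᵇ 1) (m*n%n≡0 M 2)))
                        (cong (λ k → wF f k (modS i k)) (m*n/n≡m M 2))
  where M = 3 + m

wF-sum : ∀ f k → ∑[ r < k ] wF f k (toℕ r) ≡ 0ℤ
wF-sum zero    k = ℤΣ.sum-replicate-zero k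
wF-sum (suc f) k with parity k
... | even 0 = refl
... | even 1 = refl
... | even 2 = refl
... | even (suc (suc (suc m))) = begin
  ∑[ r < M * 2 ] wF (suc f) (M * 2) (toℕ r)  ≡⟨ sum-cong-≗ {M * 2} (wF-double f m ∘ toℕ) ⟩
  ∑[ r < M * 2 ] wF f M (toℕ r % M)          ≡⟨ sum-mod-double (2 + m) (wF f M) ⟩
  ∑[ r < M ] wF f M (toℕ r) ℤ.+ ∑[ r < M ] wF f M (toℕ r)
                                            ≡⟨ cong₂ ℤ._+_ (wF-sum f M) (wF-sum f M) ⟩
  0ℤ                                        ∎
  where
  open ≡-Reasoning
  M = 3 + m
... | odd m = begin
  ∑[ r < suc (m * 2) ] wF (suc f) (suc (m * 2)) (toℕ r)
    ≡⟨ sum-cong-≗ {suc (m * 2)} (wF-odd f m ∘ toℕ) ⟩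
  ∑[ r < suc (m * 2) ] alternating (+ m) (- + suc m) (toℕ r)
    ≡⟨ alternating-sum (+ m) (- + suc m) m ⟩
  + m ℤ.+ + m ℤ.* (+ m ℤ.+ - + suc m)
    ≡⟨ cancel (+ m) ⟩
  0ℤ ∎
  where
  open ≡-Reasoning
  cancel : ∀ x → x ℤ.+ x ℤ.* (x ℤ.+ - (+ 1 ℤ.+ x)) ≡ 0ℤ
  cancel = solve-∀

if-values : ∀ {A : Set} b {x y : A} → (if b then x else y) ≡ x ⊎ (if b then x else y) ≡ y
if-values true  = inj₁ refl
if-values false = inj₂ refl

TwoValued : (ℕ → ℤ) → Set
TwoValued g = ∃₂ λ c⁺ c⁻ →
  isNeg c⁺ ≡ false × isPos c⁻ ≡ false × ∀ r → g r ≡ c⁺ ⊎ g r ≡ c⁻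

wF-twoValued : ∀ f k → TwoValued (wF f k)
wF-twoValued zero    k = 0ℤ , 0ℤ , refl , refl , λ _ → inj₁ refl
wF-twoValued (suc f) k with parity k
... | even 0 = wF-twoValued f 0
... | even 1 = + 1 , - + 1 , refl , refl , λ r → if-values (r ℕ.≡ᵇ 0)
... | even 2 = + 1 , - + 1 , refl , refl , λ r → if-values ((r ℕ.≡ᵇ 0) ∨ (r ℕ.≡ᵇ 3))
... | even (suc (suc (suc m))) =
  let c⁺ , c⁻ , c⁺≥0 , c⁻≤0 , values = wF-twoValued f (3 + m) in
  c⁺ , c⁻ , c⁺≥0 , c⁻≤0 ,
  λ r → subst (λ x → x ≡ c⁺ ⊎ x ≡ c⁻) (sym (wF-double f m r)) (values _)
... | odd m = + m , - + suc m , refl , refl ,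
  λ r → subst (λ x → x ≡ + m ⊎ x ≡ - + suc m) (sym (wF-odd f m r)) (if-values (isEven r))

-- s + suc r ≡ k expresses s = k - 1 - r without truncated subtraction.
PalindromeOn : ℕ → (ℕ → ℤ) → Set
PalindromeOn k h = ∀ s r → s + suc r ≡ k → h s ≡ h r

palindromeOn-mod-double : ∀ m (h : ℕ → ℤ) → let M = suc m in
  PalindromeOn M h → PalindromeOn (M * 2) (λ i → h (i % M))
palindromeOn-mod-double m h palindrome s r e = split (M ℕ.≤? s)
  where
  M = suc m
  e′ : s + suc r ≡ M + M
  e′ = trans e (m*2≡m+m M)
  upper : ∀ s r → M ≤ s → s + suc r ≡ M + M → h (s % M) ≡ h (r % M)
  upper s r M≤s e = begin
    h (s % M)        ≡⟨ cong (λ x → h (x % M)) (sym M+t≡s) ⟩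
    h ((M + t) % M)  ≡⟨ cong h ([m+n]%m≡n M t<M) ⟩
    h t              ≡⟨ palindrome t r t+r+1≡M ⟩
    h r              ≡⟨ cong h (sym (m<n⇒m%n≡m r<M)) ⟩
    h (r % M)        ∎
    where
    open ≡-Reasoning
    t = s ℕ.∸ M
    M+t≡s : M + t ≡ s
    M+t≡s = ℕ.m+[n∸m]≡n M≤s
    t+r+1≡M : t + suc r ≡ M
    t+r+1≡M = ℕ.+-cancelˡ-≡ M _ _ (trans (sym (ℕ.+-assoc M t (suc r))) (trans (cong (_+ suc r) M+t≡s) e))
    t<M : t < M
    t<M = subst (t <_) t+r+1≡M (ℕ.m<m+n t ℕ.z<s)
    r<M : r < M
    r<M = subst (suc r ≤_) t+r+1≡M (ℕ.m≤n+m (suc r) t)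
  split : Dec (M ≤ s) → h (s % M) ≡ h (r % M)
  split (yes M≤s) = upper s r M≤s e′
  split (no  M≰s) = sym (upper r s M≤r (trans (ℕ.+-comm r (suc s)) (trans (sym (ℕ.+-suc s r)) e′)))
    where
    open ℕ.≤-Reasoning
    M≤r : M ≤ r
    M≤r = ℕ.≤-pred (ℕ.+-cancelˡ-< M M (suc r) (begin-strict
      M + M      ≡⟨ sym e′ ⟩
      s + suc r  <⟨ ℕ.+-monoˡ-< (suc r) (ℕ.≰⇒> M≰s) ⟩
      M + suc r  ∎))

wF-palindromeOn : ∀ f k → k ≢ 2 → PalindromeOn k (wF f k)
wF-palindromeOn zero    k k≢2 s r e = refl
wF-palindromeOn (suc f) k k≢2 s r e with parity k
... | even 0 = ⊥-elim (ℕ.m+1+n≢0 s e)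
... | even 1 = ⊥-elim (k≢2 refl)
wF-palindromeOn (suc f) k k≢2 0 3 refl | even 2 = refl
wF-palindromeOn (suc f) k k≢2 1 2 refl | even 2 = refl
wF-palindromeOn (suc f) k k≢2 2 1 refl | even 2 = refl
wF-palindromeOn (suc f) k k≢2 3 0 refl | even 2 = refl
wF-palindromeOn (suc f) k k≢2 (suc (suc (suc (suc s)))) r e | even 2 =
  ⊥-elim (ℕ.m+1+n≢0 s (ℕ.suc-injective (ℕ.suc-injective (ℕ.suc-injective (ℕ.suc-injective e)))))
... | even (suc (suc (suc m))) = begin
  wF (suc f) (M * 2) s  ≡⟨ wF-double f m s ⟩
  wF f M (s % M)        ≡⟨ palindromeOn-mod-double (2 + m) (wF f M) (wF-palindromeOn f M (λ ())) s r e ⟩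
  wF f M (r % M)        ≡⟨ sym (wF-double f m r) ⟩
  wF (suc f) (M * 2) r  ∎
  where
  open ≡-Reasoning
  M = 3 + m
... | odd m = begin
  wF (suc f) (suc (m * 2)) s       ≡⟨ wF-odd f m s ⟩
  alternating (+ m) (- + suc m) s  ≡⟨ cong (λ b → if b then + m else - + suc m) same-parity ⟩
  alternating (+ m) (- + suc m) r  ≡⟨ sym (wF-odd f m r) ⟩
  wF (suc f) (suc (m * 2)) r       ∎
  where
  open ≡-Reasoning
  same-parity : isEven s ≡ isEven r
  same-parity = isEven-+⇒≡ s r
    (trans (cong isEven (ℕ.suc-injective (trans (sym (ℕ.+-suc s r)) e))) (isEven-*2 m))

w2-antipalindrome : ∀ s r → s + suc r ≡ 2 → w 2 r ≡ - w 2 s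
w2-antipalindrome 0 1 refl = refl
w2-antipalindrome 1 0 refl = refl
w2-antipalindrome (suc (suc s)) r e = ⊥-elim (ℕ.m+1+n≢0 s (ℕ.suc-injective (ℕ.suc-injective e)))

Palindromic : ∀ {n} → Vector ℤ n → Set
Palindromic u = ∀ i → u (opposite i) ≡ u i

Antipalindromic : ∀ {n} → Vector ℤ n → Set
Antipalindromic u = ∀ i → u (opposite i) ≡ - u i

opposite-reverses-< : ∀ {n} {i j : Fin n} → i Fin.< j → opposite j Fin.< opposite i
opposite-reverses-< {n} {i} {j} i<j rewrite Fin.opposite-prop i | Fin.opposite-prop j =
  ℕ.∸-monoʳ-< (ℕ.s≤s i<j) (Fin.toℕ<n j)

opposite-<ᵇ : ∀ {n} (i j : Fin n) →
  (toℕ (opposite j) ℕ.<ᵇ toℕ (opposite i)) ≡ (toℕ i ℕ.<ᵇ toℕ j)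
opposite-<ᵇ i j = det (ℕ.<ᵇ-reflects-< _ _)
  (fromEquivalence (opposite-reverses-< ∘ ℕ.<ᵇ⇒< _ _) (ℕ.<⇒<ᵇ ∘ reflect-back))
  where
  reflect-back : opposite j Fin.< opposite i → i Fin.< j
  reflect-back o<o = subst₂ Fin._<_ (Fin.opposite-involutive i) (Fin.opposite-involutive j)
                       (opposite-reverses-< o<o)

opposite-complement : ∀ {n} (i : Fin n) → toℕ (opposite i) + suc (toℕ i) ≡ n
opposite-complement i = trans (cong (_+ suc (toℕ i)) (Fin.opposite-prop i)) (ℕ.m∸n+n≡m (Fin.toℕ<n i))

rankAfter : ∀ {n} → (ℤ → Bool) → Vector ℤ n → Fin n → ℕ
rankAfter p u i = Vec.sum (Vec.tabulate (λ j → if (toℕ i ℕ.<ᵇ toℕ j) ∧ p (u j) then 1 else 0))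

rank-split : ∀ {n} p (u : Vector ℤ n) i → p (u i) ≡ true → rank p u i + suc (rankAfter p u i) ≡ cnt p u
rank-split p u fzero    e rewrite e = cong (_+ suc (cnt p (u ∘ fsuc))) (rank-zero p u)
rank-split p u (fsuc i) e = trans (ℕ.+-assoc (if p (u fzero) then 1 else 0) _ _)
  (cong (λ x → (if p (u fzero) then 1 else 0) + x) (rank-split p (u ∘ fsuc) i e))

rank-opposite : ∀ {n} p (u : Vector ℤ n) → Palindromic u → ∀ i → rank p u (opposite i) ≡ rankAfter p u i
rank-opposite {n} p u palindromic i = begin
  rank p u (opposite i)   ≡⟨ foldr-tabulate ℕ._+_ 0 F ⟩
  ℕΣ.sum F                ≡⟨ ℕΣ.sum-permute F Perm.reverse ⟩
  ℕΣ.sum (F ∘ opposite)   ≡⟨ ℕΣ.sum-cong-≗ reflected ⟩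
  ℕΣ.sum (λ j → if (toℕ i ℕ.<ᵇ toℕ j) ∧ p (u j) then 1 else 0)
                          ≡⟨ sym (foldr-tabulate ℕ._+_ 0 {n} _) ⟩
  rankAfter p u i         ∎
  where
  open ≡-Reasoning
  F : Vector ℕ n
  F j = if (toℕ j ℕ.<ᵇ toℕ (opposite i)) ∧ p (u j) then 1 else 0
  reflected : ∀ j → F (opposite j) ≡ (if (toℕ i ℕ.<ᵇ toℕ j) ∧ p (u j) then 1 else 0)
  reflected j = cong₂ (λ a b → if a ∧ b then 1 else 0) (opposite-<ᵇ i j) (cong p (palindromic j))

rank-reflection : ∀ {n} p (u : Vector ℤ n) → Palindromic u → ∀ i → p (u i) ≡ true →
  rank p u i + suc (rank p u (opposite i)) ≡ cnt p u
rank-reflection p u palindromic i e =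
  trans (cong (λ x → rank p u i + suc x) (rank-opposite p u palindromic i)) (rank-split p u i e)

ConstantOn : ∀ {I : Set} → (ℤ → Bool) → (I → ℤ) → Set
ConstantOn p u = ∃ λ c → ∀ i → p (u i) ≡ true → u i ≡ c

Leaf : ∀ {n} → Vector ℤ n → Set
Leaf u = cnt isPos u < 2 × cnt isNeg u < 2

record Admissible {n} (u : Vector ℤ n) : Set where
  field
    sum-zero          : Σ u ≡ 0ℤ
    shape             : Palindromic u ⊎ (Antipalindromic u × Leaf u)
    positive-constant : ConstantOn isPos u
    negative-constant : ConstantOn isNeg u

true≢false : true ≢ false
true≢false ()

if-cong-guarded : ∀ {A : Set} b {x y z : A} → (b ≡ true → x ≡ y) →
  (if b then x else z) ≡ (if b then y else z)
if-cong-guarded true  x≡y = x≡y refl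
if-cong-guarded false x≡y = refl

value-forced : ∀ (q : ℤ → Bool) {x c d : ℤ} →
  q d ≡ false → x ≡ c ⊎ x ≡ d → q x ≡ true → x ≡ c
value-forced q qd≡false (inj₁ x≡c) _       = x≡c
value-forced q qd≡false (inj₂ refl) qx≡true = ⊥-elim (true≢false (trans (sym qx≡true) qd≡false))

twoValued-positive : ∀ {g} → TwoValued g → ConstantOn isPos g
twoValued-positive (c⁺ , c⁻ , _ , c⁻≤0 , values) = c⁺ , λ r → value-forced isPos c⁻≤0 (values r)

twoValued-negative : ∀ {g} → TwoValued g → ConstantOn isNeg g
twoValued-negative (c⁺ , c⁻ , c⁺≥0 , _ , values) =
  c⁻ , λ r → value-forced isNeg c⁺≥0 (Sum.swap (values r))

constantOn-∘ : ∀ {I J : Set} {q : ℤ → Bool} {g : I → ℤ} →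
  ConstantOn q g → (ρ : J → I) → ConstantOn q (g ∘ ρ)
constantOn-∘ (c , const) ρ = c , const ∘ ρ

constantOn-if : ∀ {n} q → q 0ℤ ≡ false → (B : Fin n → Bool) (g : Vector ℤ n) →
  ConstantOn q g → ConstantOn q (λ i → if B i then g i else 0ℤ)
constantOn-if q q0≡false B g (c , const) = c , λ i → select (B i) (const i)
  where
  select : ∀ b {x} → (q x ≡ true → x ≡ c) →
    q (if b then x else 0ℤ) ≡ true → (if b then x else 0ℤ) ≡ c
  select true  x≡c e = x≡c e
  select false x≡c e = ⊥-elim (true≢false (trans (sym e) q0≡false))

module _ {n} (p : ℤ → Bool) (u : Vector ℤ n) where

  child-vanishes : ∀ i → p (u i) ≡ false → child p u i ≡ 0ℤ
  child-vanishes i e = cong (λ b → if b then w (cnt p u) (rank p u i) else 0ℤ) e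

  child-sum : Σ (child p u) ≡ 0ℤ
  child-sum = begin
    Σ (child p u)           ≡⟨ Σ≡sum (child p u) ⟩
    sum (child p u)         ≡⟨ sum-by-rank ℤ.+-0-monoid p u (w (cnt p u)) ⟩
    ∑[ r < cnt p u ] w (cnt p u) (toℕ r) ≡⟨ wF-sum (cnt p u) (cnt p u) ⟩
    0ℤ                      ∎
    where open ≡-Reasoning

  child-opposite : Palindromic u → ∀ i →
    child p u (opposite i) ≡ (if p (u i) then w (cnt p u) (rank p u (opposite i)) else 0ℤ)
  child-opposite palindromic i =
    cong (λ x → if p x then w (cnt p u) (rank p u (opposite i)) else 0ℤ) (palindromic i)

  child-palindromic : Palindromic u → cnt p u ≢ 2 → Palindromic (child p u)
  child-palindromic palindromic a≢2 i = trans (child-opposite palindromic i) (if-cong-guarded (p (u i))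
    (λ e → sym (wF-palindromeOn (cnt p u) (cnt p u) a≢2 _ _ (rank-reflection p u palindromic i e))))

  child-antipalindromic : Palindromic u → cnt p u ≡ 2 → Antipalindromic (child p u)
  child-antipalindromic palindromic a≡2 i = begin
    child p u (opposite i)
      ≡⟨ child-opposite palindromic i ⟩
    (if p (u i) then w (cnt p u) (rank p u (opposite i)) else 0ℤ)
      ≡⟨ if-cong-guarded (p (u i)) (λ e → reflect (rank-reflection p u palindromic i e)) ⟩
    (if p (u i) then - w (cnt p u) (rank p u i) else - 0ℤ)
      ≡⟨ sym (if-float -_ (p (u i))) ⟩
    - child p u i ∎
    where
    open ≡-Reasoning
    reflect : ∀ {s r} → s + suc r ≡ cnt p u → w (cnt p u) r ≡ - w (cnt p u) s
    reflect {s} {r} e rewrite a≡2 = w2-antipalindrome s r e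

  indicator-child : ∀ (q : ℤ → Bool) → q 0ℤ ≡ false → ∀ i →
    (if q (child p u i) then 1 else 0) ≡ (if p (u i) then (if q (w (cnt p u) (rank p u i)) then 1 else 0) else 0)
  indicator-child q q0≡false i with p (u i)
  ... | true  = refl
  ... | false = cong (λ b → if b then 1 else 0) q0≡false

  cnt-child : ∀ (q : ℤ → Bool) → q 0ℤ ≡ false →
    cnt q (child p u) ≡ ℕΣ.sum {cnt p u} (λ r → if q (w (cnt p u) (toℕ r)) then 1 else 0)
  cnt-child q q0≡false = begin
    cnt q (child p u)
      ≡⟨ cnt≡sum q (child p u) ⟩
    ℕΣ.sum (λ i → if q (child p u i) then 1 else 0)
      ≡⟨ ℕΣ.sum-cong-≗ {n} (indicator-child q q0≡false) ⟩
    ℕΣ.sum (λ i → if p (u i) then (if q (w (cnt p u) (rank p u i)) then 1 else 0) else 0)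
      ≡⟨ sum-by-rank ℕ.+-0-monoid p u (λ r → if q (w (cnt p u) r) then 1 else 0) ⟩
    ℕΣ.sum {cnt p u} (λ r → if q (w (cnt p u) (toℕ r)) then 1 else 0) ∎
    where open ≡-Reasoning

  child-leaf : cnt p u ≡ 2 → Leaf (child p u)
  child-leaf a≡2 = positive , negative
    where
    positive : cnt isPos (child p u) < 2
    positive rewrite cnt-child isPos refl | a≡2 = ℕ.n<1+n 1
    negative : cnt isNeg (child p u) < 2
    negative rewrite cnt-child isNeg refl | a≡2 = ℕ.n<1+n 1

  child-admissible : Palindromic u → Admissible (child p u)
  child-admissible palindromic = record
    { sum-zero          = child-sum
    ; shape             = shape (cnt p u ℕ.≟ 2)
    ; positive-constant = constantOn-if isPos refl B _ (constantOn-∘ {q = isPos} (twoValued-positive values) ρ)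
    ; negative-constant = constantOn-if isNeg refl B _ (constantOn-∘ {q = isNeg} (twoValued-negative values) ρ)
    }
    where
    B = λ i → p (u i)
    ρ = rank p u
    values = wF-twoValued (cnt p u) (cnt p u)
    shape : Dec (cnt p u ≡ 2) → Palindromic (child p u) ⊎ (Antipalindromic (child p u) × Leaf (child p u))
    shape (yes a≡2) = inj₂ (child-antipalindromic palindromic a≡2 , child-leaf a≡2)
    shape (no  a≢2) = inj₁ (child-palindromic palindromic a≢2)

root : ∀ n → Vector ℤ n
root n i = w n (toℕ i)

root-admissible : ∀ n → Admissible (root n)
root-admissible n = record
  { sum-zero          = trans (Σ≡sum (root n)) (wF-sum n n)
  ; shape             = shape (n ℕ.≟ 2)
  ; positive-constant = constantOn-∘ {q = isPos} (twoValued-positive values) toℕ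
  ; negative-constant = constantOn-∘ {q = isNeg} (twoValued-negative values) toℕ
  }
  where
  values = wF-twoValued n n
  shape : Dec (n ≡ 2) → Palindromic (root n) ⊎ (Antipalindromic (root n) × Leaf (root n))
  shape (yes refl) = inj₂ ((λ { fzero → refl ; (fsuc fzero) → refl }) , ℕ.n<1+n 1 , ℕ.n<1+n 1)
  shape (no  n≢2)  = inj₁ (λ i → wF-palindromeOn n n n≢2 _ _ (opposite-complement i))

_⊑_ : ∀ {n} → Vector ℤ n → Vector ℤ n → Set
v ⊑ u = ∀ i → u i ≡ 0ℤ → v i ≡ 0ℤ

VanishesOff : ∀ {n} → (ℤ → Bool) → Vector ℤ n → Vector ℤ n → Set
VanishesOff p u v = ∀ i → p (u i) ≡ false → v i ≡ 0ℤ

Orthogonal : ∀ {n} → Vector ℤ n → Vector ℤ n → Set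
Orthogonal u v = Σ (λ a → u a ℤ.* v a) ≡ 0ℤ

orthogonal-sym : ∀ {n} {u v : Vector ℤ n} → Orthogonal u v → Orthogonal v u
orthogonal-sym {u = u} {v} u⊥v = trans (Σ-cong (λ a → ℤ.*-comm (v a) (u a))) u⊥v

orthogonal-constantOn : ∀ {n} p (u : Vector ℤ n) {v : Vector ℤ n} →
  ConstantOn p u → Σ v ≡ 0ℤ → VanishesOff p u v → Orthogonal u v
orthogonal-constantOn p u {v} (c , const) Σv≡0 vanishes = begin
  Σ (λ a → u a ℤ.* v a) ≡⟨ Σ-cong pointwise ⟩
  Σ (λ a → c ℤ.* v a)   ≡⟨ Σ-scaleˡ c v ⟩
  c ℤ.* Σ v             ≡⟨ cong (c ℤ.*_) Σv≡0 ⟩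
  c ℤ.* 0ℤ              ≡⟨ ℤ.*-zeroʳ c ⟩
  0ℤ                    ∎
  where
  open ≡-Reasoning
  pointwise : ∀ a → u a ℤ.* v a ≡ c ℤ.* v a
  pointwise a with p (u a) in e
  ... | true  = cong (ℤ._* v a) (const a e)
  ... | false rewrite vanishes a e = trans (ℤ.*-zeroʳ (u a)) (sym (ℤ.*-zeroʳ c))

isPos⇒¬isNeg : ∀ x → isPos x ≡ true → isNeg x ≡ false
isPos⇒¬isNeg (+ suc _) _ = refl

orthogonal-disjoint : ∀ {n} (u : Vector ℤ n) {v v′ : Vector ℤ n} →
  VanishesOff isPos u v → VanishesOff isNeg u v′ → Orthogonal v v′
orthogonal-disjoint u {v} {v′} v-vanishes v′-vanishes = Σ-zero pointwise
  where
  pointwise : ∀ a → v a ℤ.* v′ a ≡ 0ℤ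
  pointwise a with isPos (u a) in e
  ... | false rewrite v-vanishes a e = refl
  ... | true  rewrite v′-vanishes a (isPos⇒¬isNeg (u a) e) = ℤ.*-zeroʳ (v a)

Descendants : ∀ {n} → Vector ℤ n → List (Vector ℤ n) → Set
Descendants u L = All (λ v → Admissible v × v ⊑ u) L × AllPairs Orthogonal L

preorder-descendants : ∀ f {n} (u : Vector ℤ n) → Admissible u → Descendants u (preorder f u)
preorder-descendants zero    u adm = [] , []
preorder-descendants (suc f) u adm =
  (adm , λ _ u≡0 → u≡0) ∷ All.++⁺ (All.map (below isPos refl) left) (All.map (below isNeg refl) right) ,
  u⊥descendants ∷ AllPairs.++⁺ left-pairs right-pairs left⊥right
  where
  open Admissible adm
  Branch : (ℤ → Bool) → List (Vector ℤ _) → Set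
  Branch p L = All (λ v → Admissible v × VanishesOff p u v) L × AllPairs Orthogonal L
  branch : ∀ p → (Leaf u → cnt p u < 2) →
    Branch p (if 2 ℕ.≤ᵇ cnt p u then preorder f (child p u) else [])
  branch p leaf⇒few with 2 ℕ.≤ᵇ cnt p u in e
  ... | false = [] , []
  ... | true with shape
  ...   | inj₂ (_ , leaf) =
    ⊥-elim (ℕ.<⇒≱ (leaf⇒few leaf) (ℕ.≤ᵇ⇒≤ 2 (cnt p u) (subst T (sym e) tt)))
  ...   | inj₁ palindromic =
    let all , pairs = preorder-descendants f (child p u) (child-admissible p u palindromic) in
    All.map (λ (adm′ , v⊑child) → adm′ , λ i e → v⊑child i (child-vanishes p u i e)) all , pairs
  left       = proj₁ (branch isPos proj₁)
  left-pairs = proj₂ (branch isPos proj₁)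
  right       = proj₁ (branch isNeg proj₂)
  right-pairs = proj₂ (branch isNeg proj₂)
  below : ∀ p → p 0ℤ ≡ false → ∀ {v} → Admissible v × VanishesOff p u v → Admissible v × v ⊑ u
  below p p0≡false (adm′ , vanishes) = adm′ , λ i u≡0 → vanishes i (trans (cong p u≡0) p0≡false)
  orthogonal-to-u : ∀ p → ConstantOn p u → ∀ {v} → Admissible v × VanishesOff p u v → Orthogonal u v
  orthogonal-to-u p const (adm′ , vanishes) =
    orthogonal-constantOn p u const (Admissible.sum-zero adm′) vanishes
  u⊥descendants = All.++⁺ (All.map (orthogonal-to-u isPos positive-constant) left)
                          (All.map (orthogonal-to-u isNeg negative-constant) right)
  left⊥right = All.map (λ (_ , v-vanishes) →
    All.map (λ (_ , v′-vanishes) → orthogonal-disjoint u v-vanishes v′-vanishes) right) left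

orthogonal-opposite : ∀ {n} {x y : Vector ℤ n} → Palindromic y ⊎ Antipalindromic y → Orthogonal x y →
  Σ (λ a → x a ℤ.* y (opposite a)) ≡ 0ℤ
orthogonal-opposite {x = x} {y} (inj₁ palindromic) x⊥y =
  trans (Σ-cong (λ a → cong (x a ℤ.*_) (palindromic a))) x⊥y
orthogonal-opposite {x = x} {y} (inj₂ antipalindromic) x⊥y = begin
  Σ (λ a → x a ℤ.* y (opposite a))   ≡⟨ Σ-cong negated ⟩
  Σ (λ a → ℤ.-1ℤ ℤ.* (x a ℤ.* y a))  ≡⟨ Σ-scaleˡ ℤ.-1ℤ (λ a → x a ℤ.* y a) ⟩
  ℤ.-1ℤ ℤ.* Σ (λ a → x a ℤ.* y a)    ≡⟨ cong (ℤ.-1ℤ ℤ.*_) x⊥y ⟩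
  0ℤ                                 ∎
  where
  open ≡-Reasoning
  negated : ∀ a → x a ℤ.* y (opposite a) ≡ ℤ.-1ℤ ℤ.* (x a ℤ.* y a)
  negated a = trans (cong (x a ℤ.*_) (antipalindromic a))
                    (trans (sym (ℤ.neg-distribʳ-* (x a) (y a))) (sym (ℤ.-1*i≡-i (x a ℤ.* y a))))

outer-InVbar : ∀ {n} {x y : Vector ℤ n} → Σ x ≡ 0ℤ → Σ y ≡ 0ℤ →
  Palindromic y ⊎ Antipalindromic y → Orthogonal x y → InVbar n (outer x y)
outer-InVbar {x = x} {y} Σx≡0 Σy≡0 symmetry x⊥y = record
  { rowSums = λ a → trans (Σ-scaleˡ (x a) y) (trans (cong (x a ℤ.*_) Σy≡0) (ℤ.*-zeroʳ (x a)))
  ; colSums = λ b → trans (Σ-scaleʳ (y b) x) (trans (cong (ℤ._* y b) Σx≡0) (ℤ.*-zeroˡ (y b)))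
  ; diagSum = x⊥y
  ; antiSum = orthogonal-opposite {x = x} symmetry x⊥y
  }

allPairs-lookup : ∀ {A : Set} {R : A → A → Set} → (∀ {x y} → R x y → R y x) →
  ∀ {L} → AllPairs R L → ∀ {i j} → i ≢ j → R (lookup L i) (lookup L j)
allPairs-lookup sym (_  ∷ _)   {fzero}  {fzero}  i≢j = ⊥-elim (i≢j refl)
allPairs-lookup sym (Rx ∷ _)   {fzero}  {fsuc j} _   = All.lookup Rx (∈-lookup j)
allPairs-lookup sym (Rx ∷ _)   {fsuc i} {fzero}  _   = sym (All.lookup Rx (∈-lookup i))
allPairs-lookup sym (_  ∷ Rxs) {fsuc i} {fsuc j} i≢j = allPairs-lookup sym Rxs (i≢j ∘ cong fsuc)

mainTheorem5 : (n : ℕ) → 2 ≤ n → (i j : Fin (length (U n))) → ¬ (i ≡ j) →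
    InVbar n (outer (lookup (U n) i) (lookup (U n) j))
mainTheorem5 n _ i j i≢j =
  outer-InVbar (Admissible.sum-zero (admissible i)) (Admissible.sum-zero (admissible j))
    (Sum.map₂ proj₁ (Admissible.shape (admissible j)))
    (allPairs-lookup (λ {u} {v} → orthogonal-sym {u = u} {v}) (proj₂ tree) i≢j)
  where
  tree = preorder-descendants n (root n) (root-admissible n)
  admissible : ∀ k → Admissible (lookup (U n) k)
  admissible k = proj₁ (All.lookup (proj₁ tree) (∈-lookup k))
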